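{- It is decidable whether a finite relational structure is polymorphism-homogeneous.
   Context: For a relational structure $\mathbf{A}$ and $k\geq1$, $\mathbf{A}^k$ is the direct power (carrier $A^k$, relations defined coordinatewise). A $k$-ary polymorphism is a homomorphism $\mathbf{A}^k\to\mathbf{A}$; a $k$-ary local polymorphism is a homomorphism from a finite induced substructure of $\mathbf{A}^k$ to $\mathbf{A}$. $\mathbf{A}$ is polymorphism-homogeneous if for every $k\geq1$ every $k$-ary local polymorphism extends to a $k$-ary polymorphism. -}

module Defs where

open import Data.Nat using (ℕ; _≤_)
open import Data.Fin using (Fin)
open import Data.Vec using (Vec; map; lookup)
open import Data.Vec.Relation.Unary.All using (All)
open import Data.Bool using (Bool; true)
open import Data.Product using (Σ; _×_)
open import Relation.Binary.PropositionalEquality using (_≡_)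

record Structure : Set where
  field
    n   : ℕ
    r   : ℕ
    ar  : Fin r → ℕ
    rel : (i : Fin r) → Vec (Fin n) (ar i) → Bool

module _ (A : Structure) where
  open Structure A

  Holds : (i : Fin r) → Vec (Fin n) (ar i) → Set
  Holds i t = rel i t ≡ true

  Power : ℕ → Set
  Power k = Vec (Fin n) k

  HoldsPow : (k : ℕ) (i : Fin r) → Vec (Power k) (ar i) → Set
  HoldsPow k i xs = (j : Fin k) → Holds i (map (λ x → lookup x j) xs)

  IsPolymorphism : (k : ℕ) → (Power k → Fin n) → Set
  IsPolymorphism k g =
    (i : Fin r) (xs : Vec (Power k) (ar i)) → HoldsPow k i xs → Holds i (map g xs)

  -- k-ary local polymorphism: homomorphism from the (finite) induced
  -- substructure of A^k on the subset S to A.  Only the values of f on S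
  -- matter; the induced substructure's relations are the restrictions.
  IsLocalPolymorphism : (k : ℕ) → (S : Power k → Bool) → (Power k → Fin n) → Set
  IsLocalPolymorphism k S f =
    (i : Fin r) (xs : Vec (Power k) (ar i)) → All (λ x → S x ≡ true) xs →
    HoldsPow k i xs → Holds i (map f xs)

  PolymorphismHomogeneous : Set
  PolymorphismHomogeneous =
    (k : ℕ) → 1 ≤ k → (S : Power k → Bool) (f : Power k → Fin n) →
    IsLocalPolymorphism k S f →
    Σ (Power k → Fin n) (λ g → IsPolymorphism k g × ((x : Power k) → S x ≡ true → g x ≡ f x))

module Submission where

-- For a fixed arity k the extension property is a finite check, so it suffices to bound k.
-- Extending local polymorphisms one point at a time, it is enough to extend f : S → A to a
-- single new point x. If that fails, each of the n candidate values a for x is refuted by a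
-- tuple of at most m points (m the maximal arity), n * m points of A^k in all. Keeping one
-- coordinate of A^k for each of the L = n ^ (n * m) possible columns of these points maps them
-- into A^L injectively, preserving relations and reflecting them among the points, so f is
-- carried to a local polymorphism of A^L. If it extends to a polymorphism g of A^L, then
-- a = g (image of x) is a value for x whose refuting tuple g preserves: a contradiction.
-- Hence A is polymorphism-homogeneous iff local polymorphisms of arity L extend.

open import Defs
open import Relation.Nullary using (Dec; yes; no; does; ¬_)
open import Relation.Nullary.Decidable using (_×-dec_; _→-dec_; ¬?; decidable-stable; map′; dec-true; dec-false)
open import Relation.Binary.Definitions using (DecidableEquality)
open import Relation.Binary.PropositionalEquality
  using (_≡_; _≢_; refl; sym; trans; cong; cong₂; subst; _≗_; module ≡-Reasoning)
open import Function using (_∘_)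
open import Data.Empty using (⊥; ⊥-elim)
open import Data.Product using (Σ; ∃; ∃₂; _×_; _,_; proj₁; proj₂)
open import Data.Sum using (_⊎_; inj₁; inj₂)
open import Data.Bool using (Bool; true; false; if_then_else_)
import Data.Bool.Properties as Bool
open import Data.Nat using (ℕ; zero; suc; _≤_; _*_; _≤?_; s≤s; z≤n)
open import Data.Fin using (Fin; zero; suc)
import Data.Fin.Properties as Fin
open import Data.List as List using (List; []; _∷_; length; allFin; cartesianProductWith)
import Data.List.Membership.Propositional as ListMembership
open import Data.List.Membership.Propositional.Properties using (∈-allFin; ∈-map⁺; ∈-cartesianProductWith⁺)
open import Data.List.Relation.Unary.Any as ListAny using (here; there)
open import Data.List.Relation.Unary.Any.Properties using (lookup-index)
import Data.List.Relation.Unary.All as ListAll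
open import Data.List.Extrema.Nat using (max; xs≤max)
open import Data.Vec using (Vec; []; _∷_; map; lookup; tabulate; concat; padRight; replicate; head)
open import Data.Vec.Properties
  using (≡-dec; map-cong; map-∘; lookup∘tabulate; tabulate∘lookup; tabulate-cong; ∷-injectiveˡ; ∷-injectiveʳ)
open import Data.Vec.Relation.Unary.All as All using (All)
open import Data.Vec.Relation.Unary.Any as Any using (Any)
open import Data.Vec.Membership.Propositional using (_∈_; find; lose)
open import Data.Vec.Membership.Propositional.Properties using (∈-++⁺ˡ; ∈-++⁺ʳ; ∈-tabulate⁺)

record Enumeration (X : Set) : Set where
  field
    elements : List X
    complete : ∀ x → x ListMembership.∈ elements

open Enumeration

module _ {X : Set} (E : Enumeration X) {P : X → Set} (P? : ∀ x → Dec (P x)) where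

  ∃? : Dec (∃ P)
  ∃? = map′ (λ q → let (x , _ , px) = ListMembership.find q in x , px)
            (λ (x , px) → ListMembership.lose (complete E x) px)
            (ListAny.any? P? (elements E))

  ∀? : Dec (∀ x → P x)
  ∀? = map′ (λ ps x → ListAll.lookup ps (complete E x))
            (λ h → ListAll.tabulate (λ {x} _ → h x))
            (ListAll.all? P? (elements E))

finEnumeration : ∀ {n} → Enumeration (Fin n)
finEnumeration {n} = record { elements = allFin n ; complete = ∈-allFin }

boolEnumeration : Enumeration Bool
boolEnumeration = record
  { elements = false ∷ true ∷ []
  ; complete = λ { false → here refl ; true → there (here refl) }
  }

vecEnumeration : ∀ {X} → Enumeration X → ∀ k → Enumeration (Vec X k)
vecEnumeration E zero = record
  { elements = [] ∷ []
  ; complete = λ { [] → here refl }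
  }
vecEnumeration E (suc k) = record
  { elements = cartesianProductWith _∷_ (elements E) (elements (vecEnumeration E k))
  ; complete = λ { (x ∷ xs) → ∈-cartesianProductWith⁺ _∷_ (complete E x) (complete (vecEnumeration E k) xs) }
  }

∈⇒nonEmpty : ∀ {X : Set} {x : X} {xs} → x ListMembership.∈ xs → 1 ≤ length xs
∈⇒nonEmpty (here _)  = s≤s z≤n
∈⇒nonEmpty (there _) = s≤s z≤n

-- Functions on Vec (Fin n) k are searched through their tables of values,
-- which is sound for predicates that cannot tell pointwise equal functions apart.
Table : ℕ → ℕ → Set → Set
Table n zero    X = X
Table n (suc k) X = Vec (Table n k X) n

fromTable : ∀ {X n} k → Table n k X → Vec (Fin n) k → X
fromTable zero    t []       = t
fromTable (suc k) t (c ∷ cs) = fromTable k (lookup t c) cs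

toTable : ∀ {X n} k → (Vec (Fin n) k → X) → Table n k X
toTable zero    f = f []
toTable (suc k) f = tabulate (λ c → toTable k (λ cs → f (c ∷ cs)))

fromTable-toTable : ∀ {X n} k (f : Vec (Fin n) k → X) → fromTable k (toTable k f) ≗ f
fromTable-toTable zero    f []       = refl
fromTable-toTable (suc k) f (c ∷ cs)
  rewrite lookup∘tabulate (λ c → toTable k (λ cs → f (c ∷ cs))) c = fromTable-toTable k _ cs

tableEnumeration : ∀ {X} → Enumeration X → ∀ n k → Enumeration (Table n k X)
tableEnumeration E n zero    = E
tableEnumeration E n (suc k) = vecEnumeration (tableEnumeration E n k) n

Extensional : ∀ {Y X : Set} → ((Y → X) → Set) → Set
Extensional P = ∀ {f g} → f ≗ g → P f → P g

module _ {X : Set} (E : Enumeration X) (n k : ℕ) {P : (Vec (Fin n) k → X) → Set}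
         (P-ext : Extensional P) (P? : ∀ f → Dec (P f)) where

  ∃-function? : Dec (∃ P)
  ∃-function? = map′ (λ (t , p) → fromTable k t , p)
                     (λ (f , p) → toTable k f , P-ext (sym ∘ fromTable-toTable k f) p)
                     (∃? (tableEnumeration E n k) (P? ∘ fromTable k))

  ∀-function? : Dec (∀ f → P f)
  ∀-function? = map′ (λ h f → P-ext (fromTable-toTable k f) (h (toTable k f)))
                     (λ h t → h (fromTable k t))
                     (∀? (tableEnumeration E n k) (P? ∘ fromTable k))

module _ {X : Set} where

  ∈-padRight⁺ : ∀ {m m'} (m≤m' : m ≤ m') (d : X) {y} {xs : Vec X m} → y ∈ xs → y ∈ padRight m≤m' d xs
  ∈-padRight⁺ (s≤s _)     d (Any.here y≡x)   = Any.here y≡x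
  ∈-padRight⁺ (s≤s m≤m') d (Any.there y∈xs) = Any.there (∈-padRight⁺ m≤m' d y∈xs)

  ∈-concat⁺ : ∀ {m l} {y} {xs : Vec X m} {xss : Vec (Vec X m) l} → y ∈ xs → xs ∈ xss → y ∈ concat xss
  ∈-concat⁺ y∈xs (Any.here refl)    = ∈-++⁺ˡ y∈xs
  ∈-concat⁺ y∈xs (Any.there xs∈xss) = ∈-++⁺ʳ _ (∈-concat⁺ y∈xs xs∈xss)

  map-cong-∈ : ∀ {Y : Set} {f g : X → Y} {m} {xs : Vec X m} →
               (∀ {y} → y ∈ xs → f y ≡ g y) → map f xs ≡ map g xs
  map-cong-∈ {xs = []}     f≡g = refl
  map-cong-∈ {xs = x ∷ xs} f≡g = cong₂ _∷_ (f≡g (Any.here refl)) (map-cong-∈ (f≡g ∘ Any.there))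

  map-≡⇒∈-≡ : ∀ {Y : Set} {f g : X → Y} {m} {xs : Vec X m} {y} → map f xs ≡ map g xs → y ∈ xs → f y ≡ g y
  map-≡⇒∈-≡ {xs = x ∷ xs} eq (Any.here refl)  = ∷-injectiveˡ eq
  map-≡⇒∈-≡ {xs = x ∷ xs} eq (Any.there y∈xs) = map-≡⇒∈-≡ (∷-injectiveʳ eq) y∈xs

  lookup-extensionality : ∀ {k} {x y : Vec X k} → (∀ j → lookup x j ≡ lookup y j) → x ≡ y
  lookup-extensionality {x = x} {y} x≗y =
    trans (sym (tabulate∘lookup x)) (trans (tabulate-cong x≗y) (tabulate∘lookup y))

module _ {X : Set} where

  column : ∀ {k m} → Fin k → Vec (Vec X k) m → Vec X m
  column j = map (λ x → lookup x j)

  select : ∀ {k l} → (Fin l → Fin k) → Vec X k → Vec X l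
  select σ x = tabulate (lookup x ∘ σ)

  column-select : ∀ {k l m} (σ : Fin l → Fin k) t (xs : Vec (Vec X k) m) →
                  column t (map (select σ) xs) ≡ column (σ t) xs
  column-select σ t xs = begin
    map (λ z → lookup z t) (map (select σ) xs)   ≡⟨ map-∘ _ _ xs ⟨
    map (λ x → lookup (select σ x) t) xs         ≡⟨ map-cong (λ x → lookup∘tabulate (lookup x ∘ σ) t) xs ⟩
    column (σ t) xs                              ∎
    where open ≡-Reasoning

  Covers : ∀ {k l m} → (Fin l → Fin k) → Vec (Vec X k) m → Set
  Covers σ ps = ∀ j → ∃ λ t → ∀ {y} → y ∈ ps → lookup y (σ t) ≡ lookup y j

  select-injective : ∀ {k l m} {σ : Fin l → Fin k} {ps : Vec (Vec X k) m} → Covers σ ps →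
                     ∀ {y z} → y ∈ ps → z ∈ ps → select σ y ≡ select σ z → y ≡ z
  select-injective {σ = σ} covers {y} {z} y∈ps z∈ps eq = lookup-extensionality λ j →
    let (t , same) = covers j in begin
      lookup y j              ≡⟨ same y∈ps ⟨
      lookup y (σ t)          ≡⟨ lookup∘tabulate (lookup y ∘ σ) t ⟨
      lookup (select σ y) t   ≡⟨ cong (λ w → lookup w t) eq ⟩
      lookup (select σ z) t   ≡⟨ lookup∘tabulate (lookup z ∘ σ) t ⟩
      lookup z (σ t)          ≡⟨ same z∈ps ⟩
      lookup z j              ∎
    where open ≡-Reasoning

module _ {X : Set} (E : Enumeration X) (_≟_ : DecidableEquality X) (m : ℕ) where

  columnCount : ℕ
  columnCount = length (elements (vecEnumeration E m))

  covering : ∀ {k₀} (ps : Vec (Vec X (suc k₀)) m) → Σ (Fin columnCount → Fin (suc k₀)) λ σ → Covers σ ps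
  covering {k₀} ps = σ , covers
    where
    listed : Fin columnCount → Vec X m
    listed = List.lookup (elements (vecEnumeration E m))

    Realises : Vec X m → Fin (suc k₀) → Set
    Realises c j = column j ps ≡ c

    choose : ∀ {c} → Dec (∃ (Realises c)) → Fin (suc k₀)
    choose (yes (j , _)) = j
    choose (no _)        = zero

    choose-realises : ∀ {c} (d : Dec (∃ (Realises c))) → ∃ (Realises c) → Realises c (choose d)
    choose-realises (yes (_ , realises)) _ = realises
    choose-realises (no none)            r = ⊥-elim (none r)

    realisation? : ∀ t → Dec (∃ (Realises (listed t)))
    realisation? t = Fin.any? λ j → ≡-dec _≟_ (column j ps) (listed t)

    σ : Fin columnCount → Fin (suc k₀)
    σ t = choose (realisation? t)

    covers : Covers σ ps
    covers j = t , map-≡⇒∈-≡ (trans (choose-realises (realisation? t) (j , listed-t)) (sym listed-t))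
      where
      column-listed : column j ps ListMembership.∈ elements (vecEnumeration E m)
      column-listed = complete (vecEnumeration E m) (column j ps)
      t : Fin columnCount
      t = ListAny.index column-listed
      listed-t : column j ps ≡ listed t
      listed-t = lookup-index column-listed

-- The partial map f on S, transported along e from the finitely many points ps.
module Image {X Y Z : Set} (_≟_ : DecidableEquality Y) (e : X → Y) {m} (ps : Vec X m)
             (S : X → Bool) (f : X → Z) (default : Z) where

  Preimage : Y → Set
  Preimage y = Any (λ p → S p ≡ true × e p ≡ y) ps

  preimage? : ∀ y → Dec (Preimage y)
  preimage? y = Any.any? (λ p → (S p Bool.≟ true) ×-dec (e p ≟ y)) ps

  domain : Y → Bool
  domain y = does (preimage? y)

  valueAt : ∀ {y} → Dec (Preimage y) → Z
  valueAt (yes q) = f (proj₁ (find q))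
  valueAt (no _)  = default

  value : Y → Z
  value y = valueAt (preimage? y)

  domain⇒preimage : ∀ {y} → domain y ≡ true → ∃ λ p → p ∈ ps × S p ≡ true × e p ≡ y × value y ≡ f p
  domain⇒preimage {y} = from (preimage? y)
    where
    from : (d : Dec (Preimage y)) → does d ≡ true → ∃ λ p → p ∈ ps × S p ≡ true × e p ≡ y × valueAt d ≡ f p
    from (yes q) _ = let (p , p∈ps , Sp , ep≡y) = find q in p , p∈ps , Sp , ep≡y , refl

  domain⇒preimages : ∀ {l} {ys : Vec Y l} → All (λ y → domain y ≡ true) ys →
    ∃ λ xs → All (_∈ ps) xs × All (λ p → S p ≡ true) xs × map e xs ≡ ys × map value ys ≡ map f xs
  domain⇒preimages All.[] = [] , All.[] , All.[] , refl , refl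
  domain⇒preimages (dom-y All.∷ dom-ys) =
    let (p , p∈ps , Sp , ep≡y , value≡) = domain⇒preimage dom-y
        (xs , xs⊆ps , Sxs , exs≡ys , values≡) = domain⇒preimages dom-ys
    in p ∷ xs , p∈ps All.∷ xs⊆ps , Sp All.∷ Sxs , cong₂ _∷_ ep≡y exs≡ys , cong₂ _∷_ value≡ values≡

  value-on-image : (∀ {p q} → p ∈ ps → q ∈ ps → e p ≡ e q → p ≡ q) →
          ∀ {p} → p ∈ ps → S p ≡ true → domain (e p) ≡ true × value (e p) ≡ f p
  value-on-image e-injective {p} p∈ps Sp = at (preimage? (e p))
    where
    at : (d : Dec (Preimage (e p))) → does d ≡ true × valueAt d ≡ f p
    at (yes q)  = let (p' , p'∈ps , _ , ep'≡ep) = find q in refl , cong f (e-injective p'∈ps p∈ps ep'≡ep)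
    at (no none) = ⊥-elim (none (lose p∈ps (Sp , refl)))

module _ (A : Structure) where
  open Structure A

  _≟ᴾ_ : ∀ {k} → DecidableEquality (Power A k)
  _≟ᴾ_ = ≡-dec Fin._≟_

  powerEnumeration : ∀ k → Enumeration (Power A k)
  powerEnumeration = vecEnumeration finEnumeration

  tupleEnumeration : ∀ k i → Enumeration (Vec (Power A k) (ar i))
  tupleEnumeration k i = vecEnumeration (powerEnumeration k) (ar i)

  holds? : ∀ i t → Dec (Holds A i t)
  holds? i t = rel i t Bool.≟ true

  holdsPow? : ∀ k i xs → Dec (HoldsPow A k i xs)
  holdsPow? k i xs = ∀? finEnumeration λ j → holds? i (column j xs)

  isPolymorphism? : ∀ k g → Dec (IsPolymorphism A k g)
  isPolymorphism? k g =
    ∀? finEnumeration λ i → ∀? (tupleEnumeration k i) λ xs → holdsPow? k i xs →-dec holds? i (map g xs)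

  isPolymorphism-resp-≗ : ∀ {k f g} → f ≗ g → IsPolymorphism A k f → IsPolymorphism A k g
  isPolymorphism-resp-≗ f≗g f-poly i xs related = subst (Holds A i) (map-cong f≗g xs) (f-poly i xs related)

  isLocalPolymorphism-resp-≗ : ∀ {k S S' f f'} → S ≗ S' → f ≗ f' →
                               IsLocalPolymorphism A k S f → IsLocalPolymorphism A k S' f'
  isLocalPolymorphism-resp-≗ S≗S' f≗f' f-local i xs inS' related =
    subst (Holds A i) (map-cong f≗f' xs) (f-local i xs (All.map (λ {x} → trans (S≗S' x)) inS') related)

  total-local⇒polymorphism : ∀ {k S f} → (∀ x → S x ≡ true) → IsLocalPolymorphism A k S f → IsPolymorphism A k f
  total-local⇒polymorphism total f-local i xs = f-local i xs (All.universal total xs)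

  select-preserves : ∀ {k l i} (σ : Fin l → Fin k) {xs : Vec (Power A k) (ar i)} →
                     HoldsPow A k i xs → HoldsPow A l i (map (select σ) xs)
  select-preserves {i = i} σ {xs} related t = subst (Holds A i) (sym (column-select σ t xs)) (related (σ t))

  select-reflects : ∀ {k l m i} {σ : Fin l → Fin k} {ps : Vec (Power A k) m} → Covers σ ps →
                    {xs : Vec (Power A k) (ar i)} → All (_∈ ps) xs →
                    HoldsPow A l i (map (select σ) xs) → HoldsPow A k i xs
  select-reflects {i = i} {σ} covers {xs} xs⊆ps related j =
    let (t , same) = covers j in
    subst (Holds A i) (trans (column-select σ t xs) (map-cong-∈ (same ∘ All.lookup xs⊆ps))) (related t)

  record Violation (k : ℕ) (S : Power A k → Bool) (f : Power A k → Fin n) : Set where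
    field
      symbol       : Fin r
      tuple        : Vec (Power A k) (ar symbol)
      inDomain     : All (λ x → S x ≡ true) tuple
      related      : HoldsPow A k symbol tuple
      notPreserved : ¬ Holds A symbol (map f tuple)

  violation? : ∀ k (S : Power A k → Bool) (f : Power A k → Fin n) →
    Dec (∃₂ λ i xs → All (λ x → S x ≡ true) xs × HoldsPow A k i xs × ¬ Holds A i (map f xs))
  violation? k S f = ∃? finEnumeration λ i → ∃? (tupleEnumeration k i) λ xs →
    All.all? (λ x → S x Bool.≟ true) xs ×-dec holdsPow? k i xs ×-dec ¬? (holds? i (map f xs))

  isLocalPolymorphism⊎violation : ∀ k S f → IsLocalPolymorphism A k S f ⊎ Violation k S f
  isLocalPolymorphism⊎violation k S f with violation? k S f
  ... | yes (i , xs , inS , related , notPreserved) = inj₂ (record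
        { symbol = i ; tuple = xs ; inDomain = inS ; related = related ; notPreserved = notPreserved })
  ... | no none = inj₁ λ i xs inS related →
        decidable-stable (holds? i (map f xs)) λ notPreserved → none (i , xs , inS , related , notPreserved)

  isLocalPolymorphism? : ∀ k S f → Dec (IsLocalPolymorphism A k S f)
  isLocalPolymorphism? k S f with isLocalPolymorphism⊎violation k S f
  ... | inj₁ f-local = yes f-local
  ... | inj₂ v       = no λ f-local → notPreserved (f-local symbol tuple inDomain related)
    where open Violation v

  Extends : ∀ k → (Power A k → Bool) → (Power A k → Fin n) → Set
  Extends k S f = Σ (Power A k → Fin n) λ g → IsPolymorphism A k g × ((x : Power A k) → S x ≡ true → g x ≡ f x)

  ExtensionProperty : ℕ → Set
  ExtensionProperty k = ∀ S f → IsLocalPolymorphism A k S f → Extends k S f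

  extends-resp-≗ : ∀ {k S S' f f'} → S ≗ S' → f ≗ f' → Extends k S f → Extends k S' f'
  extends-resp-≗ S≗S' f≗f' (g , g-poly , g-agrees) =
    g , g-poly , λ x S'x → trans (g-agrees x (trans (S≗S' x) S'x)) (f≗f' x)

  extends? : ∀ k S f → Dec (Extends k S f)
  extends? k S f = ∃-function? finEnumeration n k
    (λ g≗g' (g-poly , g-agrees) →
       isPolymorphism-resp-≗ g≗g' g-poly , λ x Sx → trans (sym (g≗g' x)) (g-agrees x Sx))
    (λ g → isPolymorphism? k g ×-dec ∀? (powerEnumeration k) λ x → (S x Bool.≟ true) →-dec (g x Fin.≟ f x))

  extensionProperty? : ∀ k → Dec (ExtensionProperty k)
  extensionProperty? k =
    ∀-function? boolEnumeration n k
      (λ S≗S' ext f S'-local → extends-resp-≗ S≗S' (λ _ → refl)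
                                 (ext f (isLocalPolymorphism-resp-≗ (sym ∘ S≗S') (λ _ → refl) S'-local)))
      λ S → ∀-function? finEnumeration n k
        (λ f≗f' ext f'-local → extends-resp-≗ (λ _ → refl) f≗f'
                                 (ext (isLocalPolymorphism-resp-≗ (λ _ → refl) (sym ∘ f≗f') f'-local)))
        λ f → isLocalPolymorphism? k S f →-dec extends? k S f

  module _ {k : ℕ} where

    insert : (Power A k → Bool) → Power A k → Power A k → Bool
    insert S x y = if does (y ≟ᴾ x) then true else S y

    update : (Power A k → Fin n) → Power A k → Fin n → Power A k → Fin n
    update f x a y = if does (y ≟ᴾ x) then a else f y

    insert-self : ∀ S x → insert S x x ≡ true
    insert-self S x rewrite dec-true (x ≟ᴾ x) refl = refl

    update-self : ∀ f x a → update f x a x ≡ a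
    update-self f x a rewrite dec-true (x ≟ᴾ x) refl = refl

    insert-other : ∀ S {x y} → y ≢ x → insert S x y ≡ S y
    insert-other S {x} {y} y≢x rewrite dec-false (y ≟ᴾ x) y≢x = refl

    update-other : ∀ f {x} a {y} → y ≢ x → update f x a y ≡ f y
    update-other f {x} a {y} y≢x rewrite dec-false (y ≟ᴾ x) y≢x = refl

    OnePointExtension : Set
    OnePointExtension = ∀ S f → IsLocalPolymorphism A k S f →
                        ∀ x → ∃ λ a → IsLocalPolymorphism A k (insert S x) (update f x a)

    PartialMap : Set
    PartialMap = (Power A k → Bool) × (Power A k → Fin n)

    _⊑_ : PartialMap → PartialMap → Set
    (S , f) ⊑ (S' , f') = ∀ y → S y ≡ true → S' y ≡ true × f' y ≡ f y

    ⊑-refl : ∀ {p} → p ⊑ p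
    ⊑-refl y Sy = Sy , refl

    ⊑-trans : ∀ {p q s} → p ⊑ q → q ⊑ s → p ⊑ s
    ⊑-trans p⊑q q⊑s y Sy =
      let (S'y , f'y) = p⊑q y Sy
          (S''y , f''y) = q⊑s y S'y
      in S''y , trans f''y f'y

    ⊑-insert : ∀ {S f x} a → S x ≡ false → (S , f) ⊑ (insert S x , update f x a)
    ⊑-insert {S} {f} a Sx≡false y Sy = trans (insert-other S y≢x) Sy , update-other f a y≢x
      where
      y≢x : y ≢ _
      y≢x refl with () ← trans (sym Sy) Sx≡false

    extendOver : OnePointExtension → ∀ ys S f → IsLocalPolymorphism A k S f →
                 ∃₂ λ S' f' → IsLocalPolymorphism A k S' f' × (S , f) ⊑ (S' , f') ×
                              ListAll.All (λ y → S' y ≡ true) ys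
    extendOver extend [] S f f-local = S , f , f-local , ⊑-refl , ListAll.[]
    extendOver extend (x ∷ ys) S f f-local with S x in Sx
    ... | true =
      let (S' , f' , f'-local , ⊑S' , covered) = extendOver extend ys S f f-local
      in S' , f' , f'-local , ⊑S' , proj₁ (⊑S' x Sx) ListAll.∷ covered
    ... | false =
      let (a , a-local) = extend S f f-local x
          (S' , f' , f'-local , ⊑S' , covered) = extendOver extend ys (insert S x) (update f x a) a-local
      in S' , f' , f'-local , ⊑-trans {S , f} (⊑-insert a Sx) ⊑S' ,
         proj₁ (⊑S' x (insert-self S x)) ListAll.∷ covered

    onePoint⇒extensionProperty : OnePointExtension → ExtensionProperty k
    onePoint⇒extensionProperty extend S f f-local =
      let (S' , f' , f'-local , ⊑S' , covered) = extendOver extend (elements (powerEnumeration k)) S f f-local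
          total : ∀ x → S' x ≡ true
          total x = ListAll.lookup covered (complete (powerEnumeration k) x)
      in f' , total-local⇒polymorphism total f'-local , λ x Sx → proj₂ (⊑S' x Sx)

  maxArity : ℕ
  maxArity = max 0 (List.map ar (allFin r))

  arity≤maxArity : ∀ i → ar i ≤ maxArity
  arity≤maxArity i = ListAll.lookup (xs≤max 0 _) (∈-map⁺ ar (∈-allFin i))

  -- n ^ (n * maxArity): the number of possible columns of the n * maxArity points that
  -- witness the failure of a one-point extension, one violated tuple per candidate value.
  criticalArity : ℕ
  criticalArity = columnCount (finEnumeration {n}) Fin._≟_ (n * maxArity)

  module OnePoint {k₀ : ℕ} (extendᴸ : 1 ≤ criticalArity → ExtensionProperty criticalArity)
                  (S : Power A (suc k₀) → Bool) (f : Power A (suc k₀) → Fin n)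
                  (f-local : IsLocalPolymorphism A (suc k₀) S f) (x : Power A (suc k₀))
                  (violated : ∀ a → Violation (suc k₀) (insert S x) (update f x a)) where
    open Violation

    points : Vec (Power A (suc k₀)) (n * maxArity)
    points = concat (tabulate λ a → padRight (arity≤maxArity (symbol (violated a))) x (tuple (violated a)))

    tuple⊆points : ∀ a {y} → y ∈ tuple (violated a) → y ∈ points
    tuple⊆points a y∈tuple =
      ∈-concat⁺ (∈-padRight⁺ (arity≤maxArity (symbol (violated a))) x y∈tuple) (∈-tabulate⁺ _ a)

    σ : Fin criticalArity → Fin (suc k₀)
    σ = proj₁ (covering (finEnumeration {n}) Fin._≟_ (n * maxArity) points)

    covers : Covers σ points
    covers = proj₂ (covering (finEnumeration {n}) Fin._≟_ (n * maxArity) points)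

    open Image _≟ᴾ_ (select σ) points S f (head x)

    image-local : IsLocalPolymorphism A criticalArity domain value
    image-local i ys inDomainᴸ relatedᴸ =
      let (xs , xs⊆points , Sxs , select-xs≡ys , value-ys≡f-xs) = domain⇒preimages inDomainᴸ
          related-xs : HoldsPow A (suc k₀) i xs
          related-xs = select-reflects covers xs⊆points
                         (subst (HoldsPow A criticalArity i) (sym select-xs≡ys) relatedᴸ)
      in subst (Holds A i) (sym value-ys≡f-xs) (f-local i xs Sxs related-xs)

    extension : Extends criticalArity domain value
    extension = extendᴸ L-positive domain value image-local
      where
      L-positive : 1 ≤ criticalArity
      L-positive = ∈⇒nonEmpty (complete (vecEnumeration finEnumeration (n * maxArity)) (replicate _ (head x)))

    g : Power A criticalArity → Fin n
    g = proj₁ extension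

    -- The value of the extension at the image of x is a forbidden value for x.
    a : Fin n
    a = g (select σ x)

    open Violation (violated a) using () renaming (symbol to i; tuple to xs)

    g∘select-on-xs : ∀ {y} → y ∈ xs → g (select σ y) ≡ update f x a y
    g∘select-on-xs {y} y∈xs = by-cases (y ≟ᴾ x)
      where
      open ≡-Reasoning
      by-cases : Dec (y ≡ x) → g (select σ y) ≡ update f x a y
      by-cases (yes refl) = sym (update-self f x a)
      by-cases (no y≢x)   = begin
        g (select σ y)      ≡⟨ proj₂ (proj₂ extension) (select σ y) (proj₁ image-y) ⟩
        value (select σ y)  ≡⟨ proj₂ image-y ⟩
        f y                 ≡⟨ update-other f a y≢x ⟨
        update f x a y      ∎
        where
        Sy : S y ≡ true
        Sy = trans (sym (insert-other S y≢x)) (All.lookup (inDomain (violated a)) y∈xs)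
        image-y : domain (select σ y) ≡ true × value (select σ y) ≡ f y
        image-y = value-on-image (select-injective covers) (tuple⊆points a y∈xs) Sy

    contradiction : ⊥
    contradiction = notPreserved (violated a)
      (subst (Holds A i) (trans (sym (map-∘ g (select σ) xs)) (map-cong-∈ g∘select-on-xs))
        (proj₁ (proj₂ extension) i (map (select σ) xs) (select-preserves σ (related (violated a)))))

  onePointExtension : (1 ≤ criticalArity → ExtensionProperty criticalArity) → ∀ k₀ → OnePointExtension {suc k₀}
  onePointExtension extendᴸ k₀ S f f-local x
    with Fin.any? (λ a → isLocalPolymorphism? _ (insert S x) (update f x a))
  ... | yes extendable = extendable
  ... | no none = ⊥-elim (OnePoint.contradiction extendᴸ S f f-local x violated)
    where
    violated : ∀ a → Violation (suc k₀) (insert S x) (update f x a)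
    violated a with isLocalPolymorphism⊎violation _ (insert S x) (update f x a)
    ... | inj₁ a-local = ⊥-elim (none (a , a-local))
    ... | inj₂ v       = v

mainTheorem6 : (A : Structure) → Dec (PolymorphismHomogeneous A)
mainTheorem6 A =
  map′ sufficient necessary ((1 ≤? criticalArity A) →-dec extensionProperty? A (criticalArity A))
  where
  necessary : PolymorphismHomogeneous A → 1 ≤ criticalArity A → ExtensionProperty A (criticalArity A)
  necessary homogeneous = homogeneous (criticalArity A)

  sufficient : (1 ≤ criticalArity A → ExtensionProperty A (criticalArity A)) → PolymorphismHomogeneous A
  sufficient extendᴸ (suc k₀) _ = onePoint⇒extensionProperty A (onePointExtension A extendᴸ k₀)
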